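{- For every graph $\mathbf{G}$ with $n$ vertices, if $\mathbf{G}\le_4\mathbf{K}_3$, then $\mathbf{G}\to\mathbf{K}_{3\lceil\sqrt{n}\rceil}$.
   Context: Graphs are structures with a single symmetric binary edge relation; $\mathbf{K}_m$ is the complete loopless graph on $m$ vertices, and $\mathbf{G}\to\mathbf{K}_m$ means $\mathbf{G}$ has a proper $m$-coloring (a homomorphism to $\mathbf{K}_m$). A partial homomorphism from $\mathbf{G}$ to $\mathbf{K}_3$ is a proper 3-coloring of an induced subgraph $\mathbf{G}|_X$. A $k$-strategy on $\mathbf{G}$ and $\mathbf{K}_3$ is a nonempty collection $\mathscr{H}$ of partial homomorphisms closed under restrictions such that for every $h\in\mathscr{H}$ with $|\mathrm{dom}(h)|<k$ and every vertex $x\notin\mathrm{dom}(h)$ some $f\in\mathscr{H}$ extends $h$ with $\mathrm{dom}(f)=\mathrm{dom}(h)\cup\{x\}$; $\mathbf{G}\le_k\mathbf{K}_3$ means such a strategy exists. -}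

module Defs where

open import Data.Nat using (ℕ; _+_; _*_; _≤_; _<_; suc)
open import Data.Bool using (Bool; true; false)
open import Data.Fin using (Fin)
open import Data.Fin.Subset using (Subset; ∣_∣; _∈_; _∉_; _∪_; ⁅_⁆)
open import Data.Maybe using (Maybe; just; nothing; is-just)
open import Data.Vec using (tabulate)
open import Data.Product using (Σ; ∃; _×_; _,_)
open import Relation.Binary.PropositionalEquality using (_≡_; _≢_)

-- A graph on vertex set Fin n: a symmetric Bool-valued edge relation
-- (loops are not excluded a priori, as in the paper's relational setting).
record Graph (n : ℕ) : Set where
  field
    E   : Fin n → Fin n → Bool
    sym : ∀ x y → E x y ≡ E y x
open Graph public

Adj : ∀ {n} → Graph n → Fin n → Fin n → Set
Adj G x y = E G x y ≡ true

_⟶K_ : ∀ {n} → Graph n → ℕ → Set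
G ⟶K m = Σ (_ → Fin m) λ c → ∀ x y → Adj G x y → c x ≢ c y

PMap : ℕ → Set
PMap n = Fin n → Maybe (Fin 3)

dom : ∀ {n} → PMap n → Subset n
dom h = tabulate (λ x → is-just (h x))

IsPartialHom : ∀ {n} → Graph n → PMap n → Set
IsPartialHom G h = ∀ x y a b → h x ≡ just a → h y ≡ just b → Adj G x y → a ≢ b

_⊑_ : ∀ {n} → PMap n → PMap n → Set
g ⊑ h = ∀ x a → g x ≡ just a → h x ≡ just a

record IsStrategy (k : ℕ) {n : ℕ} (G : Graph n) (H : PMap n → Set) : Set where
  field
    nonempty : ∃ λ h → H h
    partial  : ∀ h → H h → IsPartialHom G h
    restrict : ∀ h g → H h → g ⊑ h → H g
    extend   : ∀ h → H h → ∣ dom h ∣ < k → ∀ x → x ∉ dom h →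
               ∃ λ f → H f × h ⊑ f × dom f ≡ dom h ∪ ⁅ x ⁆

_≤[_]K3 : ∀ {n} → Graph n → ℕ → Set₁
G ≤[ k ]K3 = ∃ λ (H : PMap _ → Set) → IsStrategy k G H

IsCeilSqrt : ℕ → ℕ → Set
IsCeilSqrt n m = n ≤ m * m × (∀ j → n ≤ j * j → m ≤ j)

{-# OPTIONS --safe #-}
-- Wigderson's algorithm. While some vertex x has at least m neighbours among the
-- uncoloured vertices R, colour those neighbours with two fresh colours and delete them
-- from R; as |R| ≤ m², this happens at most m times. Afterwards every vertex has fewer
-- than m neighbours in R, and R is coloured greedily: m + 2m colours in total.
--
-- The neighbourhood of v is 2-colourable thanks to the 4-strategy. Fix v ↦ c in it and
-- colour the neighbours one at a time, keeping every pair of them (together with v ↦ c)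
-- inside the strategy. A new neighbour z gets a colour γ ≠ c compatible with v ↦ c; if
-- some earlier x₀ rules γ out, then extending {v, x₀, y} to z shows that the third
-- colour is compatible with every earlier y.
--
-- Membership in the strategy is not decidable, so this construction runs in the
-- double-negation monad, which is escaped because colourability of a finite graph is.
module Submission where

open import Defs hiding (sym)
open import Data.Nat using (ℕ; zero; suc; _+_; _*_; _≤_; _<_; z≤n; s≤s)
import Data.Nat.Properties as ℕ
open import Data.Bool using (Bool; true)
import Data.Bool.Properties as Bool
open import Data.Maybe using (just; nothing; is-just)
open import Data.Fin using (Fin; zero; suc; punchOut; inject≤; join; splitAt; finToFun; funToFin)
import Data.Fin.Properties as Fin
open import Data.Fin.Subset
  using (Subset; inside; outside; ∣_∣; _∈_; _∉_; _∪_; _∩_; _─_; _-_; ⁅_⁆; _⊆_; ⊥; ⊤)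
open import Data.Fin.Subset.Properties
  using ( _∈?_; nonempty?; ∈⊤; ∣⊤∣≡n; ∣⊥∣≡0; ∣⁅x⁆∣≡1; x∈⁅x⁆; drop-there; p⊆q⇒∣p∣≤∣q∣; ∣p∣≤∣x∷p∣
        ; x∈p∪q⁺; x∈p∩q⁺; x∈p∩q⁻; x∈p∧x∉q⇒x∈p─q; x∈p∧x≢y⇒x∈p-y; x∈p⇒∣p-x∣<∣p∣; p─q⊆p)
open import Data.Vec using ([]; _∷_; here; there; tabulate)
open import Data.Vec.Properties using (lookup∘tabulate; []=⇒lookup; lookup⇒[]=)
open import Data.Vec.Functional using (updateAt)
open import Data.Vec.Functional.Properties using (updateAt-updates; updateAt-minimal)
open import Data.List using (List; []; _∷_; allFin; filter)
open import Data.List.Membership.Propositional using () renaming (_∈_ to _∈ₗ_; _∉_ to _∉ₗ_)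
open import Data.List.Membership.Propositional.Properties using (∈-allFin; ∈-filter⁺; ∈-filter⁻)
import Data.List.Relation.Unary.Any as Any
open import Data.Product using (Σ; ∃; _×_; _,_; proj₁; proj₂; map₂)
open import Data.Sum using (_⊎_; inj₁; inj₂)
open import Data.Sum.Properties using (inj₁-injective; inj₂-injective)
open import Effect.Monad using (RawMonad)
open import Function using (_∘_; _$_; const)
open import Function.Definitions using (Injective)
open import Level using (0ℓ)
open import Relation.Nullary using (¬_; Dec; yes; no; contradiction)
open import Relation.Nullary.Decidable
  using (map′; ¬?; _×-dec_; _→-dec_; decidable-stable; ¬¬-excluded-middle)
open import Relation.Nullary.Negation using (¬¬-Monad; ¬¬-map)
open import Relation.Binary.PropositionalEquality
  using (_≡_; _≢_; refl; sym; trans; cong; subst; ≢-sym)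

open RawMonad (¬¬-Monad {0ℓ}) using (return; _>>=_)


∈-tabulate⁻ : ∀ {n} {f : Fin n → Bool} {x} → x ∈ tabulate f → f x ≡ true
∈-tabulate⁻ {f = f} {x} x∈ = trans (sym (lookup∘tabulate f x)) ([]=⇒lookup x∈)

∈-tabulate⁺ : ∀ {n} {f : Fin n → Bool} {x} → f x ≡ true → x ∈ tabulate f
∈-tabulate⁺ {f = f} {x} fx = lookup⇒[]= x (tabulate f) (trans (lookup∘tabulate f x) fx)

∣p∪q∣≤∣p∣+∣q∣ : ∀ {n} (p q : Subset n) → ∣ p ∪ q ∣ ≤ ∣ p ∣ + ∣ q ∣
∣p∪q∣≤∣p∣+∣q∣ []            []            = z≤n
∣p∪q∣≤∣p∣+∣q∣ (inside  ∷ p) (s ∷ q)       =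
  s≤s (ℕ.≤-trans (∣p∪q∣≤∣p∣+∣q∣ p q) (ℕ.+-monoʳ-≤ ∣ p ∣ (∣p∣≤∣x∷p∣ s q)))
∣p∪q∣≤∣p∣+∣q∣ (outside ∷ p) (inside  ∷ q) =
  ℕ.≤-trans (s≤s (∣p∪q∣≤∣p∣+∣q∣ p q)) (ℕ.≤-reflexive (sym (ℕ.+-suc ∣ p ∣ ∣ q ∣)))
∣p∪q∣≤∣p∣+∣q∣ (outside ∷ p) (outside ∷ q) = ∣p∪q∣≤∣p∣+∣q∣ p q

∣p∪⁅x⁆∣≤1+∣p∣ : ∀ {n} (p : Subset n) x → ∣ p ∪ ⁅ x ⁆ ∣ ≤ suc ∣ p ∣
∣p∪⁅x⁆∣≤1+∣p∣ p x = ℕ.≤-trans (∣p∪q∣≤∣p∣+∣q∣ p ⁅ x ⁆)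
  (ℕ.≤-reflexive (trans (cong (∣ p ∣ +_) (∣⁅x⁆∣≡1 x)) (ℕ.+-comm ∣ p ∣ 1)))

∣p─q∣+∣p∩q∣≡∣p∣ : ∀ {n} (p q : Subset n) → ∣ p ─ q ∣ + ∣ p ∩ q ∣ ≡ ∣ p ∣
∣p─q∣+∣p∩q∣≡∣p∣ []            []            = refl
∣p─q∣+∣p∩q∣≡∣p∣ (inside  ∷ p) (inside  ∷ q) =
  trans (ℕ.+-suc ∣ p ─ q ∣ ∣ p ∩ q ∣) (cong suc (∣p─q∣+∣p∩q∣≡∣p∣ p q))
∣p─q∣+∣p∩q∣≡∣p∣ (inside  ∷ p) (outside ∷ q) = cong suc (∣p─q∣+∣p∩q∣≡∣p∣ p q)
∣p─q∣+∣p∩q∣≡∣p∣ (outside ∷ p) (inside  ∷ q) = ∣p─q∣+∣p∩q∣≡∣p∣ p q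
∣p─q∣+∣p∩q∣≡∣p∣ (outside ∷ p) (outside ∷ q) = ∣p─q∣+∣p∩q∣≡∣p∣ p q

∃-∉ : ∀ {k} (p : Subset k) → ∣ p ∣ < k → ∃ λ a → a ∉ p
∃-∉ (outside ∷ p) _ = zero , λ ()
∃-∉ (inside  ∷ p) (s≤s lt) with ∃-∉ p lt
... | a , a∉p = suc a , a∉p ∘ drop-there

∃-colour-avoiding : ∀ {n k} (D : Subset n) (col : Fin n → Fin k) → ∣ D ∣ < k →
                    ∃ λ a → ∀ {y} → y ∈ D → col y ≢ a
∃-colour-avoiding {k = k} D col lt = map₂ proj₂ (avoiding D ⊥ col ⊥-bound)
  where
  ⊥-bound : ∣ D ∣ + ∣ ⊥ {k} ∣ < k
  ⊥-bound = subst (_< k) (sym (trans (cong (∣ D ∣ +_) (∣⊥∣≡0 k)) (ℕ.+-identityʳ ∣ D ∣))) lt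

  avoiding : ∀ {n k} (D : Subset n) (S : Subset k) (col : Fin n → Fin k) → ∣ D ∣ + ∣ S ∣ < k →
             ∃ λ a → a ∉ S × (∀ {y} → y ∈ D → col y ≢ a)
  avoiding []            S col lt with ∃-∉ S lt
  ... | a , a∉S = a , a∉S , λ ()
  avoiding (outside ∷ D) S col lt with avoiding D S (col ∘ suc) lt
  ... | a , a∉S , avoids = a , a∉S , λ { (there y∈D) → avoids y∈D }
  avoiding (inside  ∷ D) S col lt
    with avoiding D (S ∪ ⁅ col zero ⁆) (col ∘ suc) (ℕ.≤-<-trans bound lt)
    where
    bound : ∣ D ∣ + ∣ S ∪ ⁅ col zero ⁆ ∣ ≤ suc (∣ D ∣ + ∣ S ∣)
    bound = ℕ.≤-trans (ℕ.+-monoʳ-≤ ∣ D ∣ (∣p∪⁅x⁆∣≤1+∣p∣ S (col zero)))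
                      (ℕ.≤-reflexive (ℕ.+-suc ∣ D ∣ ∣ S ∣))
  ... | a , a∉S∪c , avoids = a , a∉S∪c ∘ x∈p∪q⁺ ∘ inj₁ , λ where
    here        c≡a → a∉S∪c (x∈p∪q⁺ (inj₂ (subst (_∈ ⁅ col zero ⁆) c≡a (x∈⁅x⁆ (col zero)))))
    (there y∈D)     → avoids y∈D


third-colour-unique : ∀ {a b c d : Fin 3} → a ≢ b → c ≢ a → c ≢ b → d ≢ a → d ≢ b → c ≡ d
third-colour-unique a≢b c≢a c≢b d≢a d≢b =
  Fin.punchOut-injective (≢-sym c≢a) (≢-sym d≢a)
    (other-of-Fin2 (c≢b ∘ Fin.punchOut-injective (≢-sym c≢a) a≢b)
                   (d≢b ∘ Fin.punchOut-injective (≢-sym d≢a) a≢b))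
  where
  other-of-Fin2 : ∀ {p q r : Fin 2} → p ≢ r → q ≢ r → p ≡ q
  other-of-Fin2 {zero}     {zero}              _   _   = refl
  other-of-Fin2 {suc zero} {suc zero}          _   _   = refl
  other-of-Fin2 {zero}     {suc zero} {zero}     p≢r _   = contradiction refl p≢r
  other-of-Fin2 {zero}     {suc zero} {suc zero} _   q≢r = contradiction refl q≢r
  other-of-Fin2 {suc zero} {zero}     {zero}     _   q≢r = contradiction refl q≢r
  other-of-Fin2 {suc zero} {zero}     {suc zero} p≢r _   = contradiction refl p≢r

-- relabels the two colours other than c as Fin 2; squeeze c c is a junk value
squeeze : Fin 3 → Fin 3 → Fin 2
squeeze c a with c Fin.≟ a
... | yes _   = zero
... | no  c≢a = punchOut c≢a

squeeze-injective : ∀ {c a b} → a ≢ c → b ≢ c → squeeze c a ≡ squeeze c b → a ≡ b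
squeeze-injective {c} {a} {b} a≢c b≢c eq with c Fin.≟ a | c Fin.≟ b
... | yes c≡a | _       = contradiction (sym c≡a) a≢c
... | no  _   | yes c≡b = contradiction (sym c≡b) b≢c
... | no  c≢a | no  c≢b = Fin.punchOut-injective c≢a c≢b eq


module Colouring {n : ℕ} (G : Graph n) where

  Nb : Fin n → Subset n
  Nb x = tabulate (E G x)

  adj-sym : ∀ {x y} → Adj G x y → Adj G y x
  adj-sym {x} {y} xy = trans (Graph.sym G y x) xy

  adj⇒∈Nb : ∀ {x y} → Adj G x y → y ∈ Nb x
  adj⇒∈Nb = ∈-tabulate⁺

  ∈Nb⇒adj : ∀ {x y} → y ∈ Nb x → Adj G x y
  ∈Nb⇒adj = ∈-tabulate⁻

  ProperOn : ∀ {A : Set} → Subset n → (Fin n → A) → Set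
  ProperOn R col = ∀ {x y} → x ∈ R → y ∈ R → Adj G x y → col x ≢ col y

  ProperOn-∘ : ∀ {A B : Set} {R} {col : Fin n → A} {f : A → B} →
               Injective _≡_ _≡_ f → ProperOn R col → ProperOn R (f ∘ col)
  ProperOn-∘ f-inj ok x∈R y∈R xy = ok x∈R y∈R xy ∘ f-inj

  splice : ∀ {A B : Set} → Subset n → (Fin n → A) → (Fin n → B) → Fin n → A ⊎ B
  splice D g f y with y ∈? D
  ... | yes _ = inj₁ (g y)
  ... | no  _ = inj₂ (f y)

  ProperOn-splice : ∀ {A B : Set} {R D} {g : Fin n → A} {f : Fin n → B} →
                    ProperOn D g → ProperOn (R ─ D) f → ProperOn R (splice D g f)
  ProperOn-splice {D = D} g-ok f-ok {x} {y} x∈R y∈R xy with x ∈? D | y ∈? D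
  ... | yes x∈D | yes y∈D = g-ok x∈D y∈D xy ∘ inj₁-injective
  ... | yes _   | no  _   = λ ()
  ... | no  _   | yes _   = λ ()
  ... | no  x∉D | no  y∉D =
    f-ok (x∈p∧x∉q⇒x∈p─q x∈R x∉D) (x∈p∧x∉q⇒x∈p─q y∈R y∉D) xy ∘ inj₂-injective

  ProperOn-updateAt : ∀ {A : Set} {R x a} {col : Fin n → A} → ¬ Adj G x x →
                      ProperOn (R - x) col → (∀ {y} → y ∈ R ∩ Nb x → col y ≢ a) →
                      ProperOn R (updateAt col x (const a))
  ProperOn-updateAt {R = R} {x} {a} {col} x≁x ok avoids {y} {z} y∈R z∈R yz
    with y Fin.≟ x | z Fin.≟ x
  ... | yes refl | yes refl = contradiction yz x≁x
  ... | yes refl | no  z≢x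
    rewrite updateAt-updates y {const a} col | updateAt-minimal z y {const a} col z≢x
    = ≢-sym (avoids (x∈p∩q⁺ (z∈R , adj⇒∈Nb yz)))
  ... | no  y≢x  | yes refl
    rewrite updateAt-updates z {const a} col | updateAt-minimal y z {const a} col y≢x
    = avoids (x∈p∩q⁺ (y∈R , adj⇒∈Nb (adj-sym yz)))
  ... | no  y≢x  | no  z≢x
    rewrite updateAt-minimal y x {const a} col y≢x | updateAt-minimal z x {const a} col z≢x
    = ok (x∈p∧x≢y⇒x∈p-y y∈R y≢x) (x∈p∧x≢y⇒x∈p-y z∈R z≢x) yz

  greedy-colouring : ∀ {K} → (∀ x → ¬ Adj G x x) → ∀ R → (∀ {x} → x ∈ R → ∣ R ∩ Nb x ∣ ≤ K) →
                     Σ (Fin n → Fin (suc K)) (ProperOn R)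
  greedy-colouring {K} loopless R = go ∣ R ∣ R ℕ.≤-refl
    where
    go : ∀ k R → ∣ R ∣ ≤ k → (∀ {x} → x ∈ R → ∣ R ∩ Nb x ∣ ≤ K) →
         Σ (Fin n → Fin (suc K)) (ProperOn R)
    go k R size deg with nonempty? R
    ... | no R-empty = (λ _ → zero) , λ x∈R → contradiction (_ , x∈R) R-empty
    go zero    R size deg | yes (x , x∈R) =
      contradiction (ℕ.<-≤-trans (x∈p⇒∣p-x∣<∣p∣ x∈R) size) ℕ.n≮0
    go (suc k) R size deg | yes (x , x∈R) with go k (R - x) size′ deg′
      where
      size′ : ∣ R - x ∣ ≤ k
      size′ = ℕ.≤-pred (ℕ.<-≤-trans (x∈p⇒∣p-x∣<∣p∣ x∈R) size)
      deg′ : ∀ {y} → y ∈ R - x → ∣ (R - x) ∩ Nb y ∣ ≤ K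
      deg′ {y} y∈R-x = ℕ.≤-trans (p⊆q⇒∣p∣≤∣q∣ shrink) (deg (p─q⊆p R ⁅ x ⁆ y∈R-x))
        where
        shrink : (R - x) ∩ Nb y ⊆ R ∩ Nb y
        shrink z∈ with x∈p∩q⁻ (R - x) (Nb y) z∈
        ... | z∈R-x , z∈Nb = x∈p∩q⁺ (p─q⊆p R ⁅ x ⁆ z∈R-x , z∈Nb)
    ... | col , ok with ∃-colour-avoiding (R ∩ Nb x) col (s≤s (deg x∈R))
    ...   | a , avoids = updateAt col x (const a) , ProperOn-updateAt (loopless x) ok avoids

  adjacent? : ∀ x y → Dec (Adj G x y)
  adjacent? x y = E G x y Bool.≟ true

  colourable? : ∀ K → Dec (G ⟶K K)
  colourable? K = map′ (λ (i , ok) → finToFun i , ok)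
                       (λ (col , ok) → funToFin col , transport col ok)
                       (Fin.any? (λ i → proper? (finToFun i)))
    where
    proper? : ∀ (col : Fin n → Fin K) → Dec (∀ x y → Adj G x y → col x ≢ col y)
    proper? col = Fin.all? λ x → Fin.all? λ y → adjacent? x y →-dec ¬? (col x Fin.≟ col y)
    transport : ∀ col → (∀ x y → Adj G x y → col x ≢ col y) →
                ∀ x y → Adj G x y → finToFun (funToFin col) x ≢ finToFun (funToFin col) y
    transport col ok x y xy eq =
      ok x y xy (trans (sym (Fin.finToFun-funToFin col x)) (trans eq (Fin.finToFun-funToFin col y)))



∅ : ∀ {n} → PMap n
∅ _ = nothing

infixl 30 _[_↦_]
_[_↦_] : ∀ {n} → PMap n → Fin n → Fin 3 → PMap n
h [ x ↦ a ] = updateAt h x (const (just a))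

∅-⊑ : ∀ {n} {h : PMap n} → ∅ ⊑ h
∅-⊑ _ _ ()

[↦]-⊑ : ∀ {n} {g h : PMap n} {x a} → g ⊑ h → h x ≡ just a → g [ x ↦ a ] ⊑ h
[↦]-⊑ {g = g} {x = x} g⊑h hx y b eq with y Fin.≟ x
... | yes refl = trans hx (trans (sym (updateAt-updates y g)) eq)
... | no  y≢x  = g⊑h y b (trans (sym (updateAt-minimal y x g y≢x)) eq)

∈dom⇒just : ∀ {n} {h : PMap n} {x} → x ∈ dom h → ∃ λ a → h x ≡ just a
∈dom⇒just {h = h} {x} x∈ with h x | ∈-tabulate⁻ {f = is-just ∘ h} x∈
... | just a  | _  = a , refl
... | nothing | ()

nothing⇒∉dom : ∀ {n} {h : PMap n} {x} → h x ≡ nothing → x ∉ dom h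
nothing⇒∉dom hx x∈ with ∈dom⇒just x∈
... | _ , hx′ = contradiction (trans (sym hx) hx′) λ ()

dom-[↦]⊆ : ∀ {n} (h : PMap n) x a → dom (h [ x ↦ a ]) ⊆ dom h ∪ ⁅ x ⁆
dom-[↦]⊆ h x a {y} y∈ with y Fin.≟ x
... | yes refl = x∈p∪q⁺ (inj₂ (x∈⁅x⁆ y))
... | no  y≢x  = x∈p∪q⁺ (inj₁ (∈-tabulate⁺
  (trans (cong is-just (sym (updateAt-minimal y x h y≢x))) (∈-tabulate⁻ y∈))))

∣dom-[↦]∣≤ : ∀ {n} (h : PMap n) x a → ∣ dom (h [ x ↦ a ]) ∣ ≤ suc ∣ dom h ∣
∣dom-[↦]∣≤ h x a = ℕ.≤-trans (p⊆q⇒∣p∣≤∣q∣ (dom-[↦]⊆ h x a)) (∣p∪⁅x⁆∣≤1+∣p∣ (dom h) x)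

∣dom-∅∣≡0 : ∀ n → ∣ dom {n} ∅ ∣ ≡ 0
∣dom-∅∣≡0 zero    = refl
∣dom-∅∣≡0 (suc n) = ∣dom-∅∣≡0 n

∣dom-∅[↦]∣≤1 : ∀ {n} (x : Fin n) a → ∣ dom (∅ [ x ↦ a ]) ∣ ≤ 1
∣dom-∅[↦]∣≤1 {n} x a = ℕ.≤-trans (∣dom-[↦]∣≤ ∅ x a) (s≤s (ℕ.≤-reflexive (∣dom-∅∣≡0 n)))


module Strategy {n : ℕ} {G : Graph n} {H : PMap n → Set} (S : IsStrategy 4 G H) where
  open IsStrategy S
  open Colouring G

  coloured-apart : ∀ {h x y a b} → H h → h x ≡ just a → h y ≡ just b → Adj G x y → a ≢ b
  coloured-apart {h} {x} {y} {a} {b} Hh = partial h Hh x y a b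

  H∅ : H ∅
  H∅ = restrict (proj₁ nonempty) ∅ (proj₂ nonempty) ∅-⊑

  extend-at : ∀ {h x} → H h → ∣ dom h ∣ < 4 → h x ≡ nothing → ∃ λ a → H (h [ x ↦ a ])
  extend-at {h} {x} Hh small hx with extend h Hh small x (nothing⇒∉dom hx)
  ... | f , Hf , h⊑f , dom-f with ∈dom⇒just (subst (x ∈_) (sym dom-f) (x∈p∪q⁺ (inj₂ (x∈⁅x⁆ x))))
  ...   | a , fx = a , restrict f _ Hf ([↦]-⊑ h⊑f fx)

  extend-∅ : ∀ x → ∃ λ a → H (∅ [ x ↦ a ])
  extend-∅ x = extend-at H∅ (s≤s (ℕ.≤-trans (ℕ.≤-reflexive (∣dom-∅∣≡0 n)) z≤n)) refl

  loopless : ∀ x → ¬ Adj G x x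
  loopless x xx with extend-∅ x
  ... | a , Ha = coloured-apart Ha (updateAt-updates x ∅) (updateAt-updates x ∅) xx refl

  adj⇒≢ : ∀ {x y} → Adj G x y → x ≢ y
  adj⇒≢ {x} xy refl = loopless x xy

  module Pinned (v : Fin n) (c : Fin 3) where

    pinned : Fin n → Fin 3 → Fin n → Fin 3 → PMap n
    pinned x a y b = ∅ [ v ↦ c ] [ x ↦ a ] [ y ↦ b ]

    ∣dom-pinned∣≤3 : ∀ x a y b → ∣ dom (pinned x a y b) ∣ ≤ 3
    ∣dom-pinned∣≤3 x a y b = ℕ.≤-trans (∣dom-[↦]∣≤ _ y b)
      (s≤s (ℕ.≤-trans (∣dom-[↦]∣≤ _ x a) (s≤s (∣dom-∅[↦]∣≤1 v c))))

    pinned-at-y : ∀ {x a y b} → pinned x a y b y ≡ just b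
    pinned-at-y {x} {a} {y} = updateAt-updates y (∅ [ v ↦ c ] [ x ↦ a ])

    pinned-at-x : ∀ {x a y b} → (x ≡ y → a ≡ b) → pinned x a y b x ≡ just a
    pinned-at-x {x} {a} {y} agree with x Fin.≟ y
    ... | yes refl = trans (updateAt-updates x _) (cong just (sym (agree refl)))
    ... | no  x≢y  = trans (updateAt-minimal x y _ x≢y) (updateAt-updates x _)

    pinned-at-v : ∀ {x a y b} → v ≢ x → v ≢ y → pinned x a y b v ≡ just c
    pinned-at-v {x} {y = y} v≢x v≢y =
      trans (updateAt-minimal v y _ v≢y) (trans (updateAt-minimal v x _ v≢x) (updateAt-updates v ∅))

    pinned-fresh : ∀ {x a y b z} → z ≢ v → z ≢ x → z ≢ y → pinned x a y b z ≡ nothing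
    pinned-fresh {x} {y = y} {z = z} z≢v z≢x z≢y =
      trans (updateAt-minimal z y _ z≢y) (trans (updateAt-minimal z x _ z≢x) (updateAt-minimal z v ∅ z≢v))

    pinned-restrict : ∀ {U x a y b} → H U → U v ≡ just c → U x ≡ just a → U y ≡ just b →
                      H (pinned x a y b)
    pinned-restrict {U} HU Uv Ux Uy = restrict U _ HU ([↦]-⊑ ([↦]-⊑ ([↦]-⊑ ∅-⊑ Uv) Ux) Uy)

    pinned-swap : ∀ {x a y b} → v ≢ x → v ≢ y → (x ≡ y → a ≡ b) →
                  H (pinned x a y b) → H (pinned y b x a)
    pinned-swap v≢x v≢y agree h =
      pinned-restrict h (pinned-at-v v≢x v≢y) pinned-at-y (pinned-at-x agree)

    pinned-diag : ∀ {x a y b} → v ≢ x → v ≢ y → H (pinned x a y b) → H (pinned y b y b)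
    pinned-diag v≢x v≢y h = pinned-restrict h (pinned-at-v v≢x v≢y) pinned-at-y pinned-at-y

    extend-pinned : ∀ {x a y b z} → v ≢ x → v ≢ y → v ≢ z → z ≢ x → z ≢ y → (x ≡ y → a ≡ b) →
                    H (pinned x a y b) → ∃ λ δ → H (pinned x a z δ) × H (pinned y b z δ)
    extend-pinned {x} {a} {y} {b} {z} v≢x v≢y v≢z z≢x z≢y agree h
      with extend-at h (s≤s (∣dom-pinned∣≤3 x a y b)) (pinned-fresh (≢-sym v≢z) z≢x z≢y)
    ... | δ , Hδ = δ , pinned-restrict Hδ at-v (at-old (pinned-at-x agree) (≢-sym z≢x)) at-z
                     , pinned-restrict Hδ at-v (at-old pinned-at-y (≢-sym z≢y)) at-z
      where
      at-old : ∀ {w e} → pinned x a y b w ≡ just e → w ≢ z → (pinned x a y b [ z ↦ δ ]) w ≡ just e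
      at-old old w≢z = trans (updateAt-minimal _ z _ w≢z) old
      at-v : (pinned x a y b [ z ↦ δ ]) v ≡ just c
      at-v = at-old (pinned-at-v v≢x v≢y) v≢z
      at-z : (pinned x a y b [ z ↦ δ ]) z ≡ just δ
      at-z = updateAt-updates z (pinned x a y b)

  module Neighbourhood (v : Fin n) (c : Fin 3) (Hvc : H (∅ [ v ↦ c ])) where
    open Pinned v c
    open import Data.List.Membership.DecPropositional (Fin._≟_ {n}) using () renaming (_∈?_ to _∈ₗ?_)

    Consistent : List (Fin n) → (Fin n → Fin 3) → Set
    Consistent L col = ∀ {x y} → x ∈ₗ L → y ∈ₗ L → ¬ ¬ H (pinned x (col x) y (col y))

    ∈-∉-≢ : ∀ {x z} {L : List (Fin n)} → x ∈ₗ L → z ∉ₗ L → x ≢ z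
    ∈-∉-≢ x∈L z∉L refl = z∉L x∈L

    consistent-assign : ∀ {z δ L col} → v ≢ z → (∀ {x} → x ∈ₗ L → v ≢ x) → z ∉ₗ L →
                        Consistent L col → (∀ {x} → x ∈ₗ L → ¬ ¬ H (pinned x (col x) z δ)) →
                        H (pinned z δ z δ) → Consistent (z ∷ L) (updateAt col z (const δ))
    consistent-assign {z} {δ} {L} {col} _ _ _ _ _ ok-zz (Any.here refl) (Any.here refl)
      rewrite updateAt-updates z {const δ} col = return ok-zz
    consistent-assign {z} {δ} {L} {col} v≢z v≢L z∉L _ ok-z _ {y = y} (Any.here refl) (Any.there y∈L)
      rewrite updateAt-updates z {const δ} col | updateAt-minimal y z {const δ} col (∈-∉-≢ y∈L z∉L)
      = ¬¬-map (pinned-swap (v≢L y∈L) v≢z (λ y≡z → contradiction y≡z (∈-∉-≢ y∈L z∉L))) (ok-z y∈L)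
    consistent-assign {z} {δ} {L} {col} _ _ z∉L _ ok-z _ {x = x} (Any.there x∈L) (Any.here refl)
      rewrite updateAt-updates z {const δ} col | updateAt-minimal x z {const δ} col (∈-∉-≢ x∈L z∉L)
      = ok-z x∈L
    consistent-assign {z} {δ} {L} {col} _ _ z∉L ok _ _ {x} {y} (Any.there x∈L) (Any.there y∈L)
      rewrite updateAt-minimal x z {const δ} col (∈-∉-≢ x∈L z∉L)
            | updateAt-minimal y z {const δ} col (∈-∉-≢ y∈L z∉L)
      = ok x∈L y∈L

    consistent-∷ : ∀ {z L col} → Adj G v z → (∀ {x} → x ∈ₗ L → Adj G v x) → Consistent L col →
                   ¬ ¬ ∃ (Consistent (z ∷ L))
    consistent-∷ {z} {L} {col} vz adjL ok with z ∈ₗ? L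
    ... | yes z∈L = return (col , λ {x} {y} x∈ y∈ → ok (absorb x∈) (absorb y∈))
      where
      absorb : ∀ {x} → x ∈ₗ z ∷ L → x ∈ₗ L
      absorb (Any.here refl) = z∈L
      absorb (Any.there x∈L) = x∈L
    ... | no z∉L = ¬¬-excluded-middle >>= λ where
        (no  none)              → return (γ-colouring none)
        (yes (x₀ , x₀∈L , ¬h₀)) → forced x₀∈L ¬h₀
      where
      v≢z : v ≢ z
      v≢z = adj⇒≢ vz
      v≢L : ∀ {x} → x ∈ₗ L → v ≢ x
      v≢L = adj⇒≢ ∘ adjL
      γ-extension : ∃ λ γ → H (∅ [ v ↦ c ] [ z ↦ γ ])
      γ-extension = extend-at Hvc (s≤s (ℕ.≤-trans (∣dom-∅[↦]∣≤1 v c) (s≤s z≤n)))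
                              (updateAt-minimal z v ∅ (≢-sym v≢z))
      γ : Fin 3
      γ = proj₁ γ-extension
      at-v : (∅ [ v ↦ c ] [ z ↦ γ ]) v ≡ just c
      at-v = trans (updateAt-minimal v z _ v≢z) (updateAt-updates v ∅)
      at-z : (∅ [ v ↦ c ] [ z ↦ γ ]) z ≡ just γ
      at-z = updateAt-updates z (∅ [ v ↦ c ])
      c≢γ : c ≢ γ
      c≢γ = coloured-apart (proj₂ γ-extension) at-v at-z vz

      γ-colouring : ¬ (∃ λ x → x ∈ₗ L × ¬ H (pinned x (col x) z γ)) → ∃ (Consistent (z ∷ L))
      γ-colouring none = updateAt col z (const γ) , λ {x} {y} →
        consistent-assign v≢z v≢L z∉L ok (λ x∈L ¬h → none (_ , x∈L , ¬h))
                            (pinned-restrict (proj₂ γ-extension) at-v at-z at-z)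

      forced : ∀ {x₀} → x₀ ∈ₗ L → ¬ H (pinned x₀ (col x₀) z γ) → ¬ ¬ ∃ (Consistent (z ∷ L))
      forced {x₀} x₀∈L ¬h₀ = do
          (δ₀ , δ₀≢c , δ₀≢γ , h₀) ← avoiding x₀∈L
          return (updateAt col z (const δ₀) , λ {x} {y} →
            consistent-assign v≢z v≢L z∉L ok (agree δ₀≢c δ₀≢γ) (pinned-diag (v≢L x₀∈L) v≢z h₀))
        where
        avoiding : ∀ {y} → y ∈ₗ L → ¬ ¬ ∃ λ δ → δ ≢ c × δ ≢ γ × H (pinned y (col y) z δ)
        avoiding {y} y∈L = do
          h ← ok x₀∈L y∈L
          (δ , hx₀ , hy) ← return (extend-pinned (v≢L x₀∈L) (v≢L y∈L) v≢z
                                     (≢-sym (∈-∉-≢ x₀∈L z∉L)) (≢-sym (∈-∉-≢ y∈L z∉L)) (cong col) h)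
          return ( δ
                 , ≢-sym (coloured-apart hy (pinned-at-v (v≢L y∈L) v≢z) pinned-at-y vz)
                 , (λ δ≡γ → ¬h₀ (subst (λ d → H (pinned x₀ (col x₀) z d)) δ≡γ hx₀))
                 , hy )
        agree : ∀ {δ₀} → δ₀ ≢ c → δ₀ ≢ γ → ∀ {y} → y ∈ₗ L → ¬ ¬ H (pinned y (col y) z δ₀)
        agree δ₀≢c δ₀≢γ {y} y∈L = do
          (δ , δ≢c , δ≢γ , hy) ← avoiding y∈L
          return (subst (λ d → H (pinned y (col y) z d))
                        (third-colour-unique c≢γ δ≢c δ≢γ δ₀≢c δ₀≢γ) hy)

    consistent : ∀ L → (∀ {x} → x ∈ₗ L → Adj G v x) → ¬ ¬ ∃ (Consistent L)
    consistent []      _    = return ((λ _ → c) , λ ())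
    consistent (z ∷ L) adjL = do
      (col , ok) ← consistent L (adjL ∘ Any.there)
      consistent-∷ (adjL (Any.here refl)) (adjL ∘ Any.there) ok

  neighbourhood-2-colourable : ∀ v → ¬ ¬ Σ (Fin n → Fin 2) (ProperOn (Nb v))
  neighbourhood-2-colourable v = ¬¬-map squeezed (consistent neighbours adjacent)
    where
    c : Fin 3
    c = proj₁ (extend-∅ v)
    open Neighbourhood v c (proj₂ (extend-∅ v))
    open Pinned v c
    neighbours : List (Fin n)
    neighbours = filter (adjacent? v) (allFin n)
    adjacent : ∀ {x} → x ∈ₗ neighbours → Adj G v x
    adjacent = proj₂ ∘ ∈-filter⁻ (adjacent? v) {xs = allFin n}
    listed : ∀ {x} → x ∈ Nb v → x ∈ₗ neighbours
    listed x∈Nb = ∈-filter⁺ (adjacent? v) (∈-allFin _) (∈Nb⇒adj x∈Nb)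
    squeezed : ∃ (Consistent neighbours) → Σ (Fin n → Fin 2) (ProperOn (Nb v))
    squeezed (col , ok) = squeeze c ∘ col , proper
      where
      ≢c : ∀ {x} → x ∈ Nb v → H (pinned x (col x) x (col x)) → col x ≢ c
      ≢c x∈Nb h = coloured-apart h pinned-at-y (pinned-at-v v≢x v≢x) (adj-sym (∈Nb⇒adj x∈Nb))
        where v≢x = adj⇒≢ (∈Nb⇒adj x∈Nb)
      proper : ProperOn (Nb v) (squeeze c ∘ col)
      proper x∈ y∈ xy eq =
        ok (listed x∈) (listed x∈) λ hx → ok (listed y∈) (listed y∈) λ hy →
        ok (listed x∈) (listed y∈) λ hxy →
        coloured-apart hxy (pinned-at-x (cong col)) pinned-at-y xy
                       (squeeze-injective (≢c x∈ hx) (≢c y∈ hy) eq)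


join-injective : ∀ m n → Injective _≡_ _≡_ (join m n)
join-injective m n {i} {j} eq =
  trans (sym (Fin.splitAt-join m n i)) (trans (cong (splitAt m) eq) (Fin.splitAt-join m n j))

palette : ℕ → ℕ → ℕ
palette k zero    = k
palette k (suc t) = 2 + palette k t

k≤palette : ∀ k t → k ≤ palette k t
k≤palette k zero    = ℕ.≤-refl
k≤palette k (suc t) = ℕ.≤-trans (k≤palette k t) (ℕ.m≤n+m _ 2)

palette≡t*2+k : ∀ k t → palette k t ≡ t * 2 + k
palette≡t*2+k k zero    = refl
palette≡t*2+k k (suc t) = trans (cong (2 +_) (palette≡t*2+k k t)) (sym (ℕ.+-assoc 2 (t * 2) k))

palette[k,k]≡3*k : ∀ k → palette k k ≡ 3 * k
palette[k,k]≡3*k k =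
  trans (palette≡t*2+k k k) (trans (ℕ.+-comm (k * 2) k) (cong (k +_) (ℕ.*-comm k 2)))

module _ {n : ℕ} {G : Graph n} {H : PMap n → Set} (S : IsStrategy 4 G H) where
  open Colouring G
  open Strategy S

  wigderson : ∀ m t R → ∣ R ∣ ≤ t * suc m → ¬ ¬ Σ (Fin n → Fin (palette (suc m) t)) (ProperOn R)
  wigderson m t R size with Fin.any? (λ x → x ∈? R ×-dec suc m ℕ.≤? ∣ R ∩ Nb x ∣)
  ... | no no-hub with greedy-colouring loopless R (λ x∈R → ℕ.≮⇒≥ (λ hub → no-hub (_ , x∈R , hub)))
  ...   | col , ok = return coloured
    where
    fits : suc m ≤ palette (suc m) t
    fits = k≤palette (suc m) t
    coloured : Σ (Fin n → Fin (palette (suc m) t)) (ProperOn R)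
    coloured = (λ y → inject≤ (col y) fits) , ProperOn-∘ (Fin.inject≤-injective fits fits _ _) ok
  wigderson m zero    R size | yes (x , x∈R , _) =
    contradiction (ℕ.<-≤-trans (x∈p⇒∣p-x∣<∣p∣ x∈R) size) ℕ.n≮0
  wigderson m (suc t) R size | yes (x , x∈R , hub) = do
      (f , f-ok) ← wigderson m t (R ─ Nb x) remaining
      (g , g-ok) ← neighbourhood-2-colourable x
      return (join 2 (palette (suc m) t) ∘ splice (Nb x) g f , λ {y} {z} →
              ProperOn-∘ (join-injective 2 _) (ProperOn-splice g-ok f-ok))
    where
    open ℕ.≤-Reasoning
    remaining : ∣ R ─ Nb x ∣ ≤ t * suc m
    remaining = ℕ.+-cancelˡ-≤ (suc m) _ _ $ begin
      suc m + ∣ R ─ Nb x ∣         ≤⟨ ℕ.+-monoˡ-≤ _ hub ⟩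
      ∣ R ∩ Nb x ∣ + ∣ R ─ Nb x ∣  ≡⟨ ℕ.+-comm ∣ R ∩ Nb x ∣ _ ⟩
      ∣ R ─ Nb x ∣ + ∣ R ∩ Nb x ∣  ≡⟨ ∣p─q∣+∣p∩q∣≡∣p∣ R (Nb x) ⟩
      ∣ R ∣                         ≤⟨ size ⟩
      suc m + t * suc m             ∎

theorem6p2 : (n : ℕ) (G : Graph n) (m : ℕ) → IsCeilSqrt n m →
    G ≤[ 4 ]K3 → G ⟶K (3 * m)
theorem6p2 zero    G zero    _          _       = (λ ()) , λ ()
theorem6p2 (suc n) G zero    (() , _)   _
theorem6p2 n       G (suc m) (n≤m² , _) (H , S) =
  decidable-stable (colourable? (3 * suc m))
    (¬¬-map total (wigderson S m (suc m) (⊤ {n}) all-vertices))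
  where
  open Colouring G
  all-vertices : ∣ ⊤ {n} ∣ ≤ suc m * suc m
  all-vertices = subst (_≤ suc m * suc m) (sym (∣⊤∣≡n n)) n≤m²
  total : Σ (Fin n → Fin (palette (suc m) (suc m))) (ProperOn (⊤ {n})) → G ⟶K (3 * suc m)
  total (col , ok) = subst (G ⟶K_) (palette[k,k]≡3*k (suc m)) (col , λ x y → ok ∈⊤ ∈⊤)
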